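{- Let $q$ be a prime power and $n\ge 3$. Let $R=\{\ell_1,\dots,\ell_{q+1}\}$ be a regulus and $R^{opp}=\{m_1,\dots,m_{q+1}\}$ its opposite regulus in some $3$-dimensional subspace $\operatorname{PG}(3,q)$ of $\operatorname{PG}(n,q)$. Let $H$ be a hyperplane of $\operatorname{PG}(n,q)$ containing no line of $R\cup R^{opp}$. Let $\ell_i'$ and $m_i'$ be the affine lines of the affine space $\operatorname{PG}(n,q)\setminus H$ obtained from $\ell_i$ and $m_i$ by removing their point in $H$, and put $R'=\{\ell_1',\dots,\ell_{q+1}'\}$, $(R^{opp})'=\{m_1',\dots,m_{q+1}'\}$. Let $Y_q$ be the graph whose vertices are the lines of the affine space $\operatorname{PG}(n,q)\setminus H$ (a graph isomorphic to $X_q(n,1)$), two distinct lines being adjacent iff they share a point of $\operatorname{PG}(n,q)\setminus H$. Define $f(\ell)=1$ for $\ell\in R'$, $f(\ell)=-1$ for $\ell\in (R^{opp})'$, and $f(\ell)=0$ otherwise. Then $f$ is a $-q$-eigenfunction of $Y_q$, and the support of $f$ induces in $Y_q$ a complete bipartite graph $K_{q+1,q+1}$ with a perfect matching removed.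
   Context: $\operatorname{PG}(n,q)$ is the projective space of subspaces of an $(n+1)$-dimensional vector space over $\mathbb{F}_q$; removing a hyperplane $H$ yields an affine space isomorphic to $\operatorname{AG}(n,q)$, whose lines are the projective lines not contained in $H$ with their point in $H$ removed. $X_q(n,1)$ is the graph on the lines of $\operatorname{AG}(n,q)$ with adjacency given by intersection. A set of lines is skew if pairwise disjoint; a transversal of a set $S$ of skew lines meets each line of $S$ in exactly one point. In a 3-dimensional projective space, a regulus is a nonempty set $R$ of pairwise skew lines such that through each point of each line of $R$ there is a transversal of $R$, and through each point of a transversal of $R$ there is a line of $R$; $R^{opp}$, the set of all transversals, is the opposite regulus, and each regulus over $\mathbb{F}_q$ has $q+1$ lines. A $\theta$-eigenfunction of a graph $G$ is a real function $f\not\equiv0$ on $V(G)$ with $\theta f(u)=\sum_{w\sim u}f(w)$ for all vertices $u$. -}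

module Defs where

open import Level using (0ℓ)
open import Algebra.Bundles using (CommutativeRing)
open import Data.Nat using (ℕ; zero; suc; _≤_)
open import Data.Fin using (Fin; zero; suc)
open import Data.Integer using (ℤ; +_; -[1+_])
import Data.Integer as ℤ
open import Data.Product using (Σ; ∃; _×_; _,_; proj₁)
open import Data.Sum using (_⊎_; inj₁; inj₂)
open import Data.Empty using (⊥)
open import Relation.Nullary using (¬_)
open import Relation.Binary.PropositionalEquality using (_≡_)
open import Function using (_∘_)

-- The standard library has no Field bundle, so a field
-- is a commutative ring (setoid equality ≈) with 1 ≉ 0 in which every
-- nonzero element is invertible.  "Of order q" = an enumeration of the
-- carrier by Fin q that is bijective up to ≈.

record FiniteField (q : ℕ) : Set₁ where
  field
    commRing : CommutativeRing 0ℓ 0ℓ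
  open CommutativeRing commRing public
  field
    1≉0      : ¬ (1# ≈ 0#)
    inverse  : ∀ x → ¬ (x ≈ 0#) → ∃ λ y → (x * y) ≈ 1#
    enum     : Fin q → Carrier
    enum-surj : ∀ x → ∃ λ i → enum i ≈ x
    enum-inj  : ∀ i j → enum i ≈ enum j → i ≡ j

sumℤ : ∀ {N} → (Fin N → ℤ) → ℤ
sumℤ {zero}  g = + 0
sumℤ {suc N} g = g zero ℤ.+ sumℤ (g ∘ suc)

-- Graphs on a setoid of vertices (vertices equal up to ≈ are the same
-- vertex), eigenfunctions, and induced K_{k,k} minus a perfect matching.

module SetoidGraph {V : Set} (_≈_ : V → V → Set) (Adj : V → V → Set) where

  IsEnumeration : (N : ℕ) → (Fin N → V) → Set
  IsEnumeration N e = (∀ v → ∃ λ i → e i ≈ v) × (∀ i j → e i ≈ e j → i ≡ j)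

  IsAdjIndicator : (V → V → ℤ) → Set
  IsAdjIndicator a = ∀ u w → (Adj u w → a u w ≡ + 1) × (¬ Adj u w → a u w ≡ + 0)

  neighbourSum : ∀ {N} → (Fin N → V) → (V → V → ℤ) → (V → ℤ) → V → ℤ
  neighbourSum e a f u = sumℤ (λ k → a u (e k) ℤ.* f (e k))

  IsEigenfunction : ℤ → (V → ℤ) → Set
  IsEigenfunction θ f =
      (∀ u v → u ≈ v → f u ≡ f v)
    × (∃ λ v → ¬ (f v ≡ + 0))
    × (∀ N (e : Fin N → V) → IsEnumeration N e →
       ∀ a → IsAdjIndicator a →
       ∀ u → θ ℤ.* f u ≡ neighbourSum e a f u)

  KMinusPMAdj : ∀ {k} → Fin k ⊎ Fin k → Fin k ⊎ Fin k → Set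
  KMinusPMAdj (inj₁ i) (inj₁ j) = ⊥
  KMinusPMAdj (inj₁ i) (inj₂ j) = ¬ (i ≡ j)
  KMinusPMAdj (inj₂ i) (inj₁ j) = ¬ (i ≡ j)
  KMinusPMAdj (inj₂ i) (inj₂ j) = ⊥

  SupportInducesKMinusPM : (V → ℤ) → ℕ → Set
  SupportInducesKMinusPM f k =
    Σ (Fin k ⊎ Fin k → V) λ φ →
        (∀ x → ¬ (f (φ x) ≡ + 0))
      × (∀ v → ¬ (f v ≡ + 0) → ∃ λ x → φ x ≈ v)
      × (∀ x y → φ x ≈ φ y → x ≡ y)
      × (∀ x y → Adj (φ x) (φ y) → KMinusPMAdj x y)
      × (∀ x y → KMinusPMAdj x y → Adj (φ x) (φ y))

module PG {q : ℕ} (F : FiniteField q) (n : ℕ) where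
  open FiniteField F using (Carrier; _≈_; _+_; _*_; 0#; 1#)

  Vect : Set
  Vect = Fin (suc n) → Carrier

  _≈ᵥ_ : Vect → Vect → Set
  u ≈ᵥ v = ∀ i → u i ≈ v i

  0ᵥ : Vect
  0ᵥ i = 0#

  _+ᵥ_ : Vect → Vect → Vect
  (u +ᵥ v) i = u i + v i

  _·_ : Carrier → Vect → Vect
  (c · v) i = c * v i

  lincomb : ∀ {k} → (Fin k → Carrier) → (Fin k → Vect) → Vect
  lincomb {zero}  c B = 0ᵥ
  lincomb {suc k} c B = (c zero · B zero) +ᵥ lincomb (c ∘ suc) (B ∘ suc)

  LinIndep : ∀ {k} → (Fin k → Vect) → Set
  LinIndep {k} B = ∀ (c : Fin k → Carrier) → lincomb c B ≈ᵥ 0ᵥ → ∀ j → c j ≈ 0#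

  NonZeroV : Vect → Set
  NonZeroV v = ¬ (v ≈ᵥ 0ᵥ)

  -- a vector subspace of dimension k (projective dimension k-1),
  -- given by a basis
  record Subspace (k : ℕ) : Set where
    field
      basis : Fin k → Vect
      indep : LinIndep basis
  open Subspace public

  _∈ₛ_ : ∀ {k} → Vect → Subspace k → Set
  x ∈ₛ S = ∃ λ c → x ≈ᵥ lincomb c (basis S)

  _⊆ₛ_ : ∀ {k l} → Subspace k → Subspace l → Set
  S ⊆ₛ T = ∀ j → basis S j ∈ₛ T

  _≈ₛ_ : ∀ {k l} → Subspace k → Subspace l → Set
  S ≈ₛ T = (S ⊆ₛ T) × (T ⊆ₛ S)

  -- projective points are nonzero vectors up to a scalar factor
  SamePoint : Vect → Vect → Set
  SamePoint x y = ∃ λ c → y ≈ᵥ (c · x)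

  Line : Set
  Line = Subspace 2

  Hyperplane : Set
  Hyperplane = Subspace n

  Solid : Set
  Solid = Subspace 4

  Meet : Line → Line → Set
  Meet L M = ∃ λ x → NonZeroV x × x ∈ₛ L × x ∈ₛ M

  Skew : Line → Line → Set
  Skew L M = ¬ Meet L M

  MeetInExactlyOnePoint : Line → Line → Set
  MeetInExactlyOnePoint L M =
    Meet L M ×
    (∀ x y → NonZeroV x → x ∈ₛ L → x ∈ₛ M →
             NonZeroV y → y ∈ₛ L → y ∈ₛ M → SamePoint x y)

  IsTransversal : ∀ {k} → Solid → (Fin k → Line) → Line → Set
  IsTransversal S ℓ t = (t ⊆ₛ S) × (∀ i → MeetInExactlyOnePoint (ℓ i) t)

  IsRegulus : ∀ {k} → Solid → (Fin k → Line) → Set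
  IsRegulus {k} S ℓ =
      (1 ≤ k)
    × (∀ i j → ℓ i ≈ₛ ℓ j → i ≡ j)
    × (∀ i → ℓ i ⊆ₛ S)
    × (∀ i j → ¬ (i ≡ j) → Skew (ℓ i) (ℓ j))
    × (∀ i x → NonZeroV x → x ∈ₛ ℓ i →
         ∃ λ t → IsTransversal S ℓ t × x ∈ₛ t)
    × (∀ t → IsTransversal S ℓ t → ∀ x → NonZeroV x → x ∈ₛ t →
         ∃ λ i → x ∈ₛ ℓ i)

  IsOppositeRegulus : ∀ {k k'} → Solid → (Fin k → Line) → (Fin k' → Line) → Set
  IsOppositeRegulus S ℓ m =
      (∀ i j → m i ≈ₛ m j → i ≡ j)
    × (∀ i → IsTransversal S ℓ (m i))
    × (∀ t → IsTransversal S ℓ t → ∃ λ i → t ≈ₛ m i)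

  -- The graph Y_q: lines of the affine space PG(n,q) \ H.  An affine
  -- line is a projective line not contained in H (with its point in H
  -- removed); it is determined by that projective line.

  AffLine : Hyperplane → Set
  AffLine H = Σ Line λ L → ¬ (L ⊆ₛ H)

  _≈ᵃ_ : ∀ {H} → AffLine H → AffLine H → Set
  u ≈ᵃ w = proj₁ u ≈ₛ proj₁ w

  AdjY : (H : Hyperplane) → AffLine H → AffLine H → Set
  AdjY H u w =
    ¬ (_≈ᵃ_ {H} u w) ×
    (∃ λ x → NonZeroV x × x ∈ₛ proj₁ u × x ∈ₛ proj₁ w × ¬ (x ∈ₛ H))

  IsReguliFunction : ∀ {k} (H : Hyperplane) → (Fin k → Line) → (Fin k → Line) →
                     (AffLine H → ℤ) → Set
  IsReguliFunction H ℓ m f =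
      (∀ v i → proj₁ v ≈ₛ ℓ i → f v ≡ + 1)
    × (∀ v i → proj₁ v ≈ₛ m i → f v ≡ -[1+ 0 ])
    × (∀ v → (∀ i → ¬ (proj₁ v ≈ₛ ℓ i)) → (∀ i → ¬ (proj₁ v ≈ₛ m i)) →
         f v ≡ + 0)

{-# OPTIONS --safe #-}
module Submission where

-- Each ℓ i meets each m j in exactly one point, distinct lines of R are skew and, less
-- obviously, so are distinct lines of R^opp. The point of ℓ i in H lies on exactly one
-- m (σ i), and σ is a permutation. Hence, as affine lines, ℓ i is adjacent to the q lines m j
-- with j ≠ σ i and to no other line of R' ∪ (R^opp)', and m j to the q lines ℓ i with σ i ≠ j:
-- this is K_{q+1,q+1} minus the matching σ, and the neighbour sums of f at ℓ i and m j are
-- -q and q. Any other affine line u meets ℓ i (resp. m j) outside H exactly when it passes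
-- through an affine point ℓ i ∩ m j; counting these points both ways, u has equally many
-- neighbours in R' and in (R^opp)', so its neighbour sum is 0. Since f vanishes off
-- R' ∪ (R^opp)', a neighbour sum over any enumeration of the vertices reduces to these cases.

open import Defs
open import Data.Nat using (ℕ; suc; _≤_)
open import Data.Fin using (Fin)
open import Data.Product using (_×_)
open import Relation.Nullary using (¬_)

import Data.Nat as ℕ
import Data.Integer
open import Data.Fin using (zero; suc; punchIn; punchOut; splitAt; join)
import Data.Fin as Fin
open import Data.Fin.Properties using (any?; all?; punchIn-punchOut; suc-injective; join-splitAt; splitAt-join)
open import Data.Vec.Functional using (_∷_; [])
open import Data.Product using (∃; _,_; proj₁; proj₂)
open import Data.Sum using (_⊎_; inj₁; inj₂; [_,_]; map₁)
open import Data.Empty using (⊥-elim)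
open import Function using (_∘_)
open import Relation.Binary using (Decidable; IsDecEquivalence)
open import Relation.Binary.PropositionalEquality as ≡ using (_≡_; _≢_)
open import Relation.Nullary using (Dec; yes; no; ¬?)
open import Relation.Nullary.Decidable using (map′; decidable-stable; ¬¬-excluded-middle; _×-dec_)

module FiniteFieldProperties {q : ℕ} (F : FiniteField q) where
  open FiniteField F hiding (zero)
  open import Algebra.Properties.Ring ring using (-‿distribˡ-*; -‿distribʳ-*; +-inverseˡ-unique)
  open import Relation.Binary.Reasoning.Setoid setoid

  _≟_ : Decidable _≈_
  x ≟ y with enum-surj x | enum-surj y
  ... | i , eᵢ≈x | j , eⱼ≈y =
    map′ (λ { ≡.refl → trans (sym eᵢ≈x) eⱼ≈y }) (λ x≈y → enum-inj i j (trans eᵢ≈x (trans x≈y (sym eⱼ≈y)))) (i Fin.≟ j)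

  ≈-stable : ∀ {x y} → ¬ ¬ x ≈ y → x ≈ y
  ≈-stable {x} {y} = decidable-stable (x ≟ y)

  ∃? : {P : Carrier → Set} → (∀ {x y} → x ≈ y → P x → P y) → (∀ x → Dec (P x)) → Dec (∃ P)
  ∃? resp P? = map′ (λ (i , p) → enum i , p) (λ (x , p) → proj₁ (enum-surj x) , resp (sym (proj₂ (enum-surj x))) p) (any? (P? ∘ enum))

  ∃ⁿ? : ∀ k {P : (Fin k → Carrier) → Set} → (∀ {c d} → (∀ i → c i ≈ d i) → P c → P d) →
        (∀ c → Dec (P c)) → Dec (∃ P)
  ∃ⁿ? ℕ.zero resp P? = map′ (_ ,_) (λ (c , p) → resp (λ ()) p) (P? [])
  ∃ⁿ? (suc k) resp P? =
    map′ (λ (x , c , p) → x ∷ c , p) (λ (c , p) → c zero , c ∘ suc , resp (λ { zero → refl ; (suc i) → refl }) p)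
         (∃? (λ x≈y (c , p) → c , resp (λ { zero → x≈y ; (suc i) → refl }) p)
             (λ x → ∃ⁿ? k (λ c≈d → resp (λ { zero → refl ; (suc i) → c≈d i })) (λ c → P? (x ∷ c))))

  2≤q : 2 ≤ q
  2≤q = distinct⇒2≤ (proj₁ (enum-surj 0#)) (proj₁ (enum-surj 1#)) 0≢1
    where
    0≢1 : proj₁ (enum-surj 0#) ≢ proj₁ (enum-surj 1#)
    0≢1 i≡j = 1≉0 (trans (sym (proj₂ (enum-surj 1#))) (trans (reflexive (≡.cong enum (≡.sym i≡j))) (proj₂ (enum-surj 0#))))
    distinct⇒2≤ : ∀ {r} (i j : Fin r) → i ≢ j → 2 ≤ r
    distinct⇒2≤ {suc ℕ.zero} zero zero i≢j = ⊥-elim (i≢j ≡.refl)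
    distinct⇒2≤ {suc (suc r)} _ _ _ = ℕ.s≤s (ℕ.s≤s ℕ.z≤n)

  linear-solution : ∀ {a} → ¬ a ≈ 0# → ∃ λ c → ∀ {y b} → a * y + b ≈ 0# → y ≈ c * b
  linear-solution {a} a≉0 with inverse a a≉0
  ... | a⁻¹ , a*a⁻¹≈1 = - a⁻¹ , λ {y} {b} ay+b≈0 → begin
    y                ≈⟨ *-identityˡ y ⟨
    1# * y           ≈⟨ *-congʳ (trans (*-comm a⁻¹ a) a*a⁻¹≈1) ⟨
    (a⁻¹ * a) * y    ≈⟨ *-assoc a⁻¹ a y ⟩
    a⁻¹ * (a * y)    ≈⟨ *-congˡ (+-inverseˡ-unique (a * y) b ay+b≈0) ⟩
    a⁻¹ * - b        ≈⟨ -‿distribʳ-* a⁻¹ b ⟨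
    - (a⁻¹ * b)      ≈⟨ -‿distribˡ-* a⁻¹ b ⟩
    - a⁻¹ * b        ∎

  *-cancel-≉0 : ∀ {a y} → ¬ a ≈ 0# → a * y ≈ 0# → y ≈ 0#
  *-cancel-≉0 {a} {y} a≉0 ay≈0 with linear-solution a≉0
  ... | c , solve = trans (solve (trans (+-identityʳ (a * y)) ay≈0)) (zeroʳ c)

module RowDependence {q : ℕ} (F : FiniteField q) where
  open FiniteField F hiding (zero)
  open FiniteFieldProperties F
  open import Algebra.Properties.Ring ring using (-‿distribˡ-*; -‿distribʳ-*; x[y-z]≈xy-xz)
  open import Algebra.Properties.Semiring.Sum semiring
    using (sum; sum-syntax; ∑-distrib-+; *-distribʳ-sum; sum-cong-≋; sum-replicate-zero)
  open import Relation.Binary.Reasoning.Setoid setoid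

  sum-zero : ∀ {k} {g : Fin k → Carrier} → (∀ i → g i ≈ 0#) → sum g ≈ 0#
  sum-zero {k} g≈0 = trans (sum-cong-≋ g≈0) (sum-replicate-zero k)

  Nontrivial : ∀ {k} → (Fin k → Carrier) → Set
  Nontrivial c = ∃ λ j → ¬ c j ≈ 0#

  elimination-identity : ∀ {m} (c t y : Fin m → Carrier) x →
    - (∑[ i < m ] (c i * t i)) * x + ∑[ i < m ] (c i * y i) ≈ ∑[ i < m ] (c i * (y i - t i * x))
  elimination-identity {m} c t y x = begin
    - (∑[ i < m ] (c i * t i)) * x + ∑[ i < m ] (c i * y i)  ≈⟨ +-comm _ _ ⟩
    ∑[ i < m ] (c i * y i) + - (∑[ i < m ] (c i * t i)) * x  ≈⟨ +-congˡ (trans (sym (-‿distribˡ-* _ x)) (-‿distribʳ-* _ x)) ⟩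
    ∑[ i < m ] (c i * y i) + ∑[ i < m ] (c i * t i) * - x    ≈⟨ +-congˡ (*-distribʳ-sum {m} (- x) _) ⟩
    ∑[ i < m ] (c i * y i) + ∑[ i < m ] (c i * t i * - x)    ≈⟨ ∑-distrib-+ {m} _ _ ⟨
    ∑[ i < m ] (c i * y i + c i * t i * - x)                 ≈⟨ sum-cong-≋ {m} termwise ⟩
    ∑[ i < m ] (c i * (y i - t i * x))                       ∎
    where
    termwise : ∀ i → c i * y i + c i * t i * - x ≈ c i * (y i - t i * x)
    termwise i = begin
      c i * y i + c i * t i * - x      ≈⟨ +-congˡ (trans (*-assoc (c i) (t i) (- x)) (*-congˡ (sym (-‿distribʳ-* (t i) x)))) ⟩
      c i * y i + c i * - (t i * x)    ≈⟨ +-congˡ (-‿distribʳ-* (c i) (t i * x)) ⟨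
      c i * y i - c i * (t i * x)      ≈⟨ x[y-z]≈xy-xz (c i) (y i) (t i * x) ⟨
      c i * (y i - t i * x)            ∎

  -- Gaussian elimination: pivot on a nonzero entry of row 0, clear its column in the other
  -- rows, and recurse on those d rows of length d - 1.
  dependent-rows : ∀ d (A : Fin (suc d) → Fin d → Carrier) →
                   ∃ λ c → Nontrivial c × ∀ k → ∑[ i < suc d ] (c i * A i k) ≈ 0#
  dependent-rows ℕ.zero A = (λ _ → 1#) , (zero , 1≉0) , λ ()
  dependent-rows (suc d) A with any? (λ k → ¬? (A zero k ≟ 0#))
  ... | no row₀≈0 = (1# ∷ λ _ → 0#) , (zero , 1≉0) , λ k → begin
    1# * A zero k + ∑[ i < suc d ] (0# * A (suc i) k)  ≈⟨ +-cong (*-identityˡ _) (sum-zero {suc d} (λ i → zeroˡ (A (suc i) k))) ⟩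
    A zero k + 0#                                      ≈⟨ +-identityʳ _ ⟩
    A zero k                                           ≈⟨ ≈-stable (λ A₀ₖ≉0 → row₀≈0 (k , A₀ₖ≉0)) ⟩
    0#                                                 ∎
  ... | yes (p , A₀ₚ≉0) with inverse (A zero p) A₀ₚ≉0
  ...   | a , A₀ₚ*a≈1 = - ∑[ i < suc d ] (c′ i * t i) ∷ c′ , (suc j , c′ⱼ≉0) , vanishes
    where
    t : Fin (suc d) → Carrier
    t i = A (suc i) p * a
    B : Fin (suc d) → Fin d → Carrier
    B i k = A (suc i) (punchIn p k) - t i * A zero (punchIn p k)
    c′ = proj₁ (dependent-rows d B)
    j = proj₁ (proj₁ (proj₂ (dependent-rows d B)))
    c′ⱼ≉0 = proj₂ (proj₁ (proj₂ (dependent-rows d B)))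
    c′B≈0 = proj₂ (proj₂ (dependent-rows d B))
    reduced : ∀ k → ∑[ i < suc (suc d) ] ((- ∑[ i < suc d ] (c′ i * t i) ∷ c′) i * A i k)
                    ≈ ∑[ i < suc d ] (c′ i * (A (suc i) k - t i * A zero k))
    reduced k = elimination-identity c′ t (λ i → A (suc i) k) (A zero k)
    a*A₀ₚ≈1 : ∀ {x} → x * (a * A zero p) ≈ x * 1#
    a*A₀ₚ≈1 = *-congˡ (trans (*-comm a _) A₀ₚ*a≈1)
    pivot-column : ∀ i → A (suc i) p - t i * A zero p ≈ 0#
    pivot-column i = begin
      A (suc i) p - A (suc i) p * a * A zero p     ≈⟨ +-congˡ (-‿cong (trans (*-assoc _ a _) a*A₀ₚ≈1)) ⟩
      A (suc i) p - A (suc i) p * 1#               ≈⟨ +-congˡ (-‿cong (*-identityʳ _)) ⟩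
      A (suc i) p - A (suc i) p                    ≈⟨ -‿inverseʳ _ ⟩
      0#                                           ∎
    vanishes : ∀ k → ∑[ i < suc (suc d) ] ((- ∑[ i < suc d ] (c′ i * t i) ∷ c′) i * A i k) ≈ 0#
    vanishes k with p Fin.≟ k
    ... | yes ≡.refl = trans (reduced p) (sum-zero {suc d} (λ i → trans (*-congˡ (pivot-column i)) (zeroʳ (c′ i))))
    ... | no p≢k = trans (reduced k) (≡.subst (λ k → ∑[ i < suc d ] (c′ i * (A (suc i) k - t i * A zero k)) ≈ 0#)
                                               (punchIn-punchOut p≢k) (c′B≈0 (punchOut p≢k)))

module IntegerSums where
  open import Data.Integer using (ℤ; +_; _+_; _*_; -_)
  import Data.Integer.Properties as ℤ
  open import Algebra.Properties.CommutativeMonoid.Sum ℤ.+-0-commutativeMonoid using (sum; ∑-comm)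
  open ≡ using (refl; cong; cong₂; sym; trans)
  open ≡.≡-Reasoning

  indicator : ∀ {A : Set} → Dec A → ℤ
  indicator (yes _) = + 1
  indicator (no _) = + 0

  indicator-yes : ∀ {A : Set} → A → (d : Dec A) → indicator d ≡ + 1
  indicator-yes a (yes _) = refl
  indicator-yes a (no ¬a) = ⊥-elim (¬a a)

  indicator-no : ∀ {A : Set} → ¬ A → (d : Dec A) → indicator d ≡ + 0
  indicator-no ¬a (yes a) = ⊥-elim (¬a a)
  indicator-no ¬a (no _) = refl

  sumℤ-cong : ∀ {N} {g h : Fin N → ℤ} → (∀ i → g i ≡ h i) → sumℤ g ≡ sumℤ h
  sumℤ-cong {ℕ.zero} g≡h = refl
  sumℤ-cong {suc N} g≡h = cong₂ _+_ (g≡h zero) (sumℤ-cong (g≡h ∘ suc))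

  sumℤ-zero : ∀ {N} (g : Fin N → ℤ) → (∀ i → g i ≡ + 0) → sumℤ g ≡ + 0
  sumℤ-zero {ℕ.zero} g g≡0 = refl
  sumℤ-zero {suc N} g g≡0 = cong₂ _+_ (g≡0 zero) (sumℤ-zero (g ∘ suc) (g≡0 ∘ suc))

  sumℤ-single : ∀ {N} (g : Fin N → ℤ) k₀ → (∀ k → k ≢ k₀ → g k ≡ + 0) → sumℤ g ≡ g k₀
  sumℤ-single g zero g≡0 = trans (cong (_+_ (g zero)) (sumℤ-zero (g ∘ suc) (λ k → g≡0 (suc k) (λ ())))) (ℤ.+-identityʳ (g zero))
  sumℤ-single g (suc k₀) g≡0 =
    trans (cong₂ _+_ (g≡0 zero (λ ())) (sumℤ-single (g ∘ suc) k₀ (λ k k≢k₀ → g≡0 (suc k) (k≢k₀ ∘ suc-injective))))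
          (ℤ.+-identityˡ (g (suc k₀)))

  sumℤ-count : ∀ {N} (g : Fin (suc N) → ℤ) k₀ → g k₀ ≡ + 0 → (∀ k → k ≢ k₀ → g k ≡ + 1) → sumℤ g ≡ + N
  sumℤ-count {N} g zero g₀≡0 g≡1 = trans (cong₂ _+_ g₀≡0 (ones N (g ∘ suc) (λ k → g≡1 (suc k) (λ ())))) (ℤ.+-identityˡ (+ N))
    where
    ones : ∀ N (g : Fin N → ℤ) → (∀ k → g k ≡ + 1) → sumℤ g ≡ + N
    ones ℕ.zero g g≡1 = refl
    ones (suc N) g g≡1 = cong₂ _+_ (g≡1 zero) (ones N (g ∘ suc) (g≡1 ∘ suc))
  sumℤ-count {suc N} g (suc k₀) g₀≡0 g≡1 =
    cong₂ _+_ (g≡1 zero (λ ())) (sumℤ-count (g ∘ suc) k₀ g₀≡0 (λ k k≢k₀ → g≡1 (suc k) (k≢k₀ ∘ suc-injective)))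

  sumℤ-neg : ∀ {N} (g : Fin N → ℤ) → sumℤ (λ i → - g i) ≡ - sumℤ g
  sumℤ-neg {ℕ.zero} g = refl
  sumℤ-neg {suc N} g = trans (cong (_+_ (- g zero)) (sumℤ-neg (g ∘ suc))) (sym (ℤ.neg-distrib-+ (g zero) (sumℤ (g ∘ suc))))

  sumℤ-splitAt : ∀ a {b} (g : Fin a ⊎ Fin b → ℤ) → sumℤ (g ∘ splitAt a) ≡ sumℤ (g ∘ inj₁) + sumℤ (g ∘ inj₂)
  sumℤ-splitAt ℕ.zero g = sym (ℤ.+-identityˡ (sumℤ (g ∘ inj₂)))
  sumℤ-splitAt (suc a) g =
    trans (cong (_+_ (g (inj₁ zero))) (sumℤ-splitAt a (g ∘ map₁ suc))) (sym (ℤ.+-assoc (g (inj₁ zero)) _ _))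

  sumℤ≡sum : ∀ {N} (g : Fin N → ℤ) → sumℤ g ≡ sum g
  sumℤ≡sum {ℕ.zero} g = refl
  sumℤ≡sum {suc N} g = cong (_+_ (g zero)) (sumℤ≡sum (g ∘ suc))

  sumℤ-comm : ∀ {N K} (g : Fin N → Fin K → ℤ) → sumℤ (λ i → sumℤ (g i)) ≡ sumℤ (λ j → sumℤ (λ i → g i j))
  sumℤ-comm {N} {K} g = begin
    sumℤ (λ i → sumℤ (g i))            ≡⟨ trans (sumℤ-cong (λ i → sumℤ≡sum (g i))) (sumℤ≡sum (λ i → sum (g i))) ⟩
    sum (λ i → sum (g i))              ≡⟨ ∑-comm g ⟩
    sum (λ j → sum (λ i → g i j))      ≡⟨ trans (sumℤ-cong (λ j → sumℤ≡sum (λ i → g i j))) (sumℤ≡sum (λ j → sum (λ i → g i j))) ⟨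
    sumℤ (λ j → sumℤ (λ i → g i j))    ∎

  sumℤ-indicator-unique : ∀ {N} {T : Fin N → Set} (T? : ∀ j → Dec (T j)) → (∀ {j j′} → T j → T j′ → j ≡ j′) →
                          sumℤ (λ j → indicator (T? j)) ≡ indicator (any? T?)
  sumℤ-indicator-unique T? T-unique with any? T?
  ... | yes (j₀ , t₀) =
    trans (sumℤ-single (λ j → indicator (T? j)) j₀ (λ j j≢j₀ → indicator-no (λ t → j≢j₀ (T-unique t t₀)) (T? j)))
          (indicator-yes t₀ (T? j₀))
  ... | no none = sumℤ-zero (λ j → indicator (T? j)) (λ j → indicator-no (λ t → none (j , t)) (T? j))

module EnumerationSums {V : Set} {_≈_ : V → V → Set} (≈-isDecEquivalence : IsDecEquivalence _≈_) where
  open IsDecEquivalence ≈-isDecEquivalence renaming (_≟_ to _≈?_; sym to ≈-sym; trans to ≈-trans)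
  open import Data.Integer using (ℤ; +_; _*_)
  import Data.Integer.Properties as ℤ
  open IntegerSums
  open ≡ using (cong; trans)

  -- Both sides equal ∑ₖ ∑ₓ [e k ≈ φ x] g (φ x).
  sum-over-enumeration : ∀ {N K} (e : Fin N → V) → (∀ v → ∃ λ k → e k ≈ v) → (∀ k k′ → e k ≈ e k′ → k ≡ k′) →
                         (φ : Fin K → V) → (∀ x y → φ x ≈ φ y → x ≡ y) →
                         (g : V → ℤ) → (∀ {u v} → u ≈ v → g u ≡ g v) → (∀ v → g v ≢ + 0 → ∃ λ x → φ x ≈ v) →
                         sumℤ (g ∘ e) ≡ sumℤ (g ∘ φ)
  sum-over-enumeration {N} {K} e e-onto e-injective φ φ-injective g g-resp g-support =
    trans (sumℤ-cong by-φ) (trans (sumℤ-comm T) (sumℤ-cong by-e))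
    where
    T : Fin N → Fin K → ℤ
    T k x = indicator (e k ≈? φ x) * g (φ x)
    T-off : ∀ {k x} → ¬ e k ≈ φ x → T k x ≡ + 0
    T-off {k} {x} ek≉φx = cong (_* g (φ x)) (indicator-no ek≉φx (e k ≈? φ x))
    T-on : ∀ {k x} → e k ≈ φ x → T k x ≡ g (φ x)
    T-on {k} {x} ek≈φx = trans (cong (_* g (φ x)) (indicator-yes ek≈φx (e k ≈? φ x))) (ℤ.*-identityˡ (g (φ x)))
    by-φ : ∀ k → g (e k) ≡ sumℤ (T k)
    by-φ k with any? (λ x → e k ≈? φ x)
    ... | yes (x₀ , ek≈φx₀) = ≡.sym (trans (sumℤ-single (T k) x₀ off) (trans (T-on ek≈φx₀) (g-resp (≈-sym ek≈φx₀))))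
      where
      off : ∀ x → x ≢ x₀ → T k x ≡ + 0
      off x x≢x₀ = T-off (λ ek≈φx → x≢x₀ (φ-injective x x₀ (≈-trans (≈-sym ek≈φx) ek≈φx₀)))
    ... | no ≉φ = trans gek≡0 (≡.sym (sumℤ-zero (T k) (λ x → T-off (λ ek≈φx → ≉φ (x , ek≈φx)))))
      where
      gek≡0 : g (e k) ≡ + 0
      gek≡0 = decidable-stable (g (e k) ℤ.≟ + 0) λ gek≢0 →
        let (x , φx≈ek) = g-support (e k) gek≢0 in ≉φ (x , ≈-sym φx≈ek)
    by-e : ∀ x → sumℤ (λ k → T k x) ≡ g (φ x)
    by-e x with e-onto (φ x)
    ... | k₀ , ek₀≈φx = trans (sumℤ-single (λ k → T k x) k₀ off) (T-on ek₀≈φx)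
      where
      off : ∀ k → k ≢ k₀ → T k x ≡ + 0
      off k k≢k₀ = T-off (λ ek≈φx → k≢k₀ (e-injective k k₀ (≈-trans ek≈φx (≈-sym ek₀≈φx))))

module AdjacencyIndicators {V : Set} (_≈_ Adj : V → V → Set) where
  open SetoidGraph _≈_ Adj using (IsAdjIndicator)
  open import Data.Integer using (ℤ)
  import Data.Integer.Properties as ℤ
  open IntegerSums using (indicator)

  adjIndicator-cong : ∀ {a} → IsAdjIndicator a → ∀ {u w u′ w′} →
                      (Adj u w → Adj u′ w′) → (Adj u′ w′ → Adj u w) → a u w ≡ a u′ w′
  adjIndicator-cong {a} a-ind {u} {w} {u′} {w′} to from =
    decidable-stable (a u w ℤ.≟ a u′ w′) λ ≢ → ¬¬-excluded-middle λ where
      (yes adj) → ≢ (≡.trans (proj₁ (a-ind u w) adj) (≡.sym (proj₁ (a-ind u′ w′) (to adj))))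
      (no ¬adj) → ≢ (≡.trans (proj₂ (a-ind u w) ¬adj) (≡.sym (proj₂ (a-ind u′ w′) (¬adj ∘ from))))

  adjIndicator≡indicator : ∀ {a} → IsAdjIndicator a → ∀ {u w} {A : Set} (d : Dec A) →
                           (Adj u w → A) → (A → Adj u w) → a u w ≡ indicator d
  adjIndicator≡indicator a-ind {u} {w} (yes x) _ from = proj₁ (a-ind u w) (from x)
  adjIndicator≡indicator a-ind {u} {w} (no ¬x) to _ = proj₂ (a-ind u w) (¬x ∘ to)

two-distinct-others : ∀ {k} → 2 ≤ k → (i : Fin (suc k)) →
                      ∃ λ a → ∃ λ b → a ≢ b × a ≢ i × b ≢ i
two-distinct-others (ℕ.s≤s (ℕ.s≤s _)) zero = suc zero , suc (suc zero) , (λ ()) , (λ ()) , (λ ())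
two-distinct-others (ℕ.s≤s (ℕ.s≤s _)) (suc zero) = zero , suc (suc zero) , (λ ()) , (λ ()) , (λ ())
two-distinct-others (ℕ.s≤s (ℕ.s≤s _)) (suc (suc i)) = zero , suc zero , (λ ()) , (λ ()) , (λ ())

module Projective {q : ℕ} (F : FiniteField q) (n : ℕ) where
  open FiniteField F hiding (zero)
  open FiniteFieldProperties F
  open RowDependence F
  open PG F n
  open import Algebra.Properties.Ring ring using (-1*x≈-x; +-inverseˡ-unique)
  open import Algebra.Properties.Semiring.Sum semiring
    using (sum-syntax; ∑-comm; ∑-distrib-+; *-distribˡ-sum; *-distribʳ-sum; sum-cong-≋)
  open import Relation.Binary.Reasoning.Setoid setoid

  ≈ᵥ-sym : ∀ {x y} → x ≈ᵥ y → y ≈ᵥ x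
  ≈ᵥ-sym x≈y i = sym (x≈y i)

  ≈ᵥ-trans : ∀ {x y z} → x ≈ᵥ y → y ≈ᵥ z → x ≈ᵥ z
  ≈ᵥ-trans x≈y y≈z i = trans (x≈y i) (y≈z i)

  lincomb-coord : ∀ {k} (c : Fin k → Carrier) (B : Fin k → Vect) i →
                  lincomb c B i ≈ ∑[ j < k ] (c j * B j i)
  lincomb-coord {ℕ.zero} c B i = refl
  lincomb-coord {suc k} c B i = +-congˡ (lincomb-coord (c ∘ suc) (B ∘ suc) i)

  lincomb-cong : ∀ {k} {c d : Fin k → Carrier} (B : Fin k → Vect) → (∀ j → c j ≈ d j) →
                 lincomb c B ≈ᵥ lincomb d B
  lincomb-cong {ℕ.zero} B c≈d i = refl
  lincomb-cong {suc k} B c≈d i = +-cong (*-congʳ (c≈d zero)) (lincomb-cong (B ∘ suc) (c≈d ∘ suc) i)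

  lincomb-zero : ∀ {k} (B : Fin k → Vect) → lincomb (λ _ → 0#) B ≈ᵥ 0ᵥ
  lincomb-zero {ℕ.zero} B i = refl
  lincomb-zero {suc k} B i = trans (+-cong (zeroˡ _) (lincomb-zero (B ∘ suc) i)) (+-identityˡ 0#)

  lincomb-+ : ∀ {k} (c d : Fin k → Carrier) (B : Fin k → Vect) →
              (lincomb c B +ᵥ lincomb d B) ≈ᵥ lincomb (λ j → c j + d j) B
  lincomb-+ {k} c d B i = begin
    lincomb c B i + lincomb d B i                       ≈⟨ +-cong (lincomb-coord c B i) (lincomb-coord d B i) ⟩
    ∑[ j < k ] (c j * B j i) + ∑[ j < k ] (d j * B j i) ≈⟨ ∑-distrib-+ {k} _ _ ⟨
    ∑[ j < k ] (c j * B j i + d j * B j i)              ≈⟨ sum-cong-≋ {k} (λ j → distribʳ (B j i) (c j) (d j)) ⟨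
    ∑[ j < k ] ((c j + d j) * B j i)                    ≈⟨ lincomb-coord _ B i ⟨
    lincomb (λ j → c j + d j) B i                       ∎

  lincomb-· : ∀ {k} a (c : Fin k → Carrier) (B : Fin k → Vect) →
              (a · lincomb c B) ≈ᵥ lincomb (λ j → a * c j) B
  lincomb-· {k} a c B i = begin
    a * lincomb c B i              ≈⟨ *-congˡ (lincomb-coord c B i) ⟩
    a * ∑[ j < k ] (c j * B j i)   ≈⟨ *-distribˡ-sum {k} a _ ⟩
    ∑[ j < k ] (a * (c j * B j i)) ≈⟨ sum-cong-≋ {k} (λ j → *-assoc a (c j) (B j i)) ⟨
    ∑[ j < k ] (a * c j * B j i)   ≈⟨ lincomb-coord _ B i ⟨
    lincomb (λ j → a * c j) B i    ∎

  _∈span_ : ∀ {k} → Vect → (Fin k → Vect) → Set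
  x ∈span G = ∃ λ c → x ≈ᵥ lincomb c G

  ∈span-resp : ∀ {k} {G : Fin k → Vect} {x y} → x ≈ᵥ y → x ∈span G → y ∈span G
  ∈span-resp x≈y (c , x≈cG) = c , ≈ᵥ-trans (≈ᵥ-sym x≈y) x≈cG

  ∈span-zero : ∀ {k} (G : Fin k → Vect) → 0ᵥ ∈span G
  ∈span-zero G = (λ _ → 0#) , ≈ᵥ-sym (lincomb-zero G)

  ∈span-+ : ∀ {k} {G : Fin k → Vect} {x y} → x ∈span G → y ∈span G → (x +ᵥ y) ∈span G
  ∈span-+ {G = G} (c , x≈) (d , y≈) = _ , λ i → trans (+-cong (x≈ i) (y≈ i)) (lincomb-+ c d G i)

  ∈span-· : ∀ {k} {G : Fin k → Vect} {x} a → x ∈span G → (a · x) ∈span G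
  ∈span-· {G = G} a (c , x≈) = _ , λ i → trans (*-congˡ (x≈ i)) (lincomb-· a c G i)

  lincomb-∈span : ∀ {k l} {G : Fin k → Vect} (B : Fin l → Vect) → (∀ j → B j ∈span G) →
                  ∀ c → lincomb c B ∈span G
  lincomb-∈span {l = ℕ.zero} {G} B B⊆G c = ∈span-zero G
  lincomb-∈span {l = suc l} B B⊆G c =
    ∈span-+ (∈span-· (c zero) (B⊆G zero)) (lincomb-∈span (B ∘ suc) (B⊆G ∘ suc) (c ∘ suc))

  ∈span-trans : ∀ {k l} {G : Fin k → Vect} {B : Fin l → Vect} {x} →
                x ∈span B → (∀ j → B j ∈span G) → x ∈span G
  ∈span-trans {B = B} (c , x≈) B⊆G = ∈span-resp (≈ᵥ-sym x≈) (lincomb-∈span B B⊆G c)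

  ∈span-member : ∀ {k} (G : Fin k → Vect) j → G j ∈span G
  ∈span-member G zero = (1# ∷ λ _ → 0#) , λ i → sym (begin
    1# * G zero i + lincomb (λ _ → 0#) (G ∘ suc) i ≈⟨ +-cong (*-identityˡ _) (lincomb-zero (G ∘ suc) i) ⟩
    G zero i + 0#                                   ≈⟨ +-identityʳ _ ⟩
    G zero i                                        ∎)
  ∈span-member G (suc j) with ∈span-member (G ∘ suc) j
  ... | c , Gⱼ≈ = (0# ∷ c) , λ i → trans (Gⱼ≈ i) (sym (trans (+-congʳ (zeroˡ _)) (+-identityˡ _)))

  SamePoint-∈ₛ : ∀ {k} (S : Subspace k) {x y} → SamePoint x y → x ∈ₛ S → y ∈ₛ S
  SamePoint-∈ₛ S (c , y≈cx) x∈S = ∈span-resp (≈ᵥ-sym y≈cx) (∈span-· c x∈S)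

  ⊆ₛ-refl : ∀ {k} (S : Subspace k) → S ⊆ₛ S
  ⊆ₛ-refl S = ∈span-member (basis S)

  ⊆ₛ-∈ : ∀ {k l} {S : Subspace k} {T : Subspace l} {x} → S ⊆ₛ T → x ∈ₛ S → x ∈ₛ T
  ⊆ₛ-∈ S⊆T x∈S = ∈span-trans x∈S S⊆T

  ≈ₛ-refl : ∀ {k} (S : Subspace k) → S ≈ₛ S
  ≈ₛ-refl S = ⊆ₛ-refl S , ⊆ₛ-refl S

  ≈ₛ-sym : ∀ {k l} {S : Subspace k} {T : Subspace l} → S ≈ₛ T → T ≈ₛ S
  ≈ₛ-sym (S⊆T , T⊆S) = T⊆S , S⊆T

  ≈ₛ-trans : ∀ {k l m} {S : Subspace k} {T : Subspace l} {U : Subspace m} → S ≈ₛ T → T ≈ₛ U → S ≈ₛ U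
  ≈ₛ-trans {S = S} {T} {U} (S⊆T , T⊆S) (T⊆U , U⊆T) =
    (λ j → ⊆ₛ-∈ {S = T} {U} T⊆U (S⊆T j)) , (λ j → ⊆ₛ-∈ {S = T} {S} T⊆S (U⊆T j))

  dependent : ∀ {k} (V : Fin (suc k) → Vect) (G : Fin k → Vect) → (∀ i → V i ∈span G) →
              ∃ λ c → Nontrivial c × lincomb c V ≈ᵥ 0ᵥ
  dependent {k} V G V⊆G with dependent-rows k (λ i → proj₁ (V⊆G i))
  ... | c , c≢0 , cW≈0 = c , c≢0 , λ t → begin
    lincomb c V t                                          ≈⟨ lincomb-coord c V t ⟩
    ∑[ i < suc k ] (c i * V i t)                           ≈⟨ sum-cong-≋ {suc k} (λ i → *-congˡ {c i} (V-coord i t)) ⟩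
    ∑[ i < suc k ] (c i * ∑[ j < k ] (W i j * G j t))      ≈⟨ sum-cong-≋ {suc k} (λ i → *-distribˡ-sum {k} (c i) (λ j → W i j * G j t)) ⟩
    ∑[ i < suc k ] ∑[ j < k ] (c i * (W i j * G j t))      ≈⟨ ∑-comm {suc k} {k} (λ i j → c i * (W i j * G j t)) ⟩
    ∑[ j < k ] ∑[ i < suc k ] (c i * (W i j * G j t))      ≈⟨ sum-cong-≋ {k} (λ j → sum-cong-≋ {suc k} (λ i → *-assoc (c i) (W i j) (G j t))) ⟨
    ∑[ j < k ] ∑[ i < suc k ] (c i * W i j * G j t)        ≈⟨ sum-cong-≋ {k} (λ j → *-distribʳ-sum {suc k} (G j t) (λ i → c i * W i j)) ⟨
    ∑[ j < k ] (∑[ i < suc k ] (c i * W i j) * G j t)      ≈⟨ sum-zero {k} (λ j → trans (*-congʳ (cW≈0 j)) (zeroˡ (G j t))) ⟩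
    0#                                                     ∎
    where
    W : Fin (suc k) → Fin k → Carrier
    W i = proj₁ (V⊆G i)
    V-coord : ∀ i t → V i t ≈ ∑[ j < k ] (W i j * G j t)
    V-coord i t = trans (proj₂ (V⊆G i) t) (lincomb-coord (W i) G t)

  distinct-points-independent : ∀ {x y} → NonZeroV x → ¬ SamePoint x y → LinIndep (x ∷ y ∷ [])
  distinct-points-independent {x} {y} x≢0 x≁y c cV≈0 = λ { zero → c₀≈0 ; (suc zero) → c₁≈0 }
    where
    c₁y+c₀x≈0 : ∀ i → c (suc zero) * y i + c zero * x i ≈ 0#
    c₁y+c₀x≈0 i = trans (+-comm _ _) (trans (+-congˡ (sym (+-identityʳ _))) (cV≈0 i))
    c₁≈0 : c (suc zero) ≈ 0#
    c₁≈0 = ≈-stable λ c₁≉0 → let (κ , solve) = linear-solution c₁≉0 in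
      x≁y (κ * c zero , λ i → trans (solve (c₁y+c₀x≈0 i)) (sym (*-assoc κ (c zero) (x i))))
    c₀≈0 : c zero ≈ 0#
    c₀≈0 = ≈-stable λ c₀≉0 → x≢0 λ i →
      *-cancel-≉0 c₀≉0 (trans (sym (trans (+-congʳ (trans (*-congʳ c₁≈0) (zeroˡ (y i)))) (+-identityˡ _))) (c₁y+c₀x≈0 i))

  ∈span-of-dependent-∷ : ∀ {k} {w : Vect} {V : Fin k → Vect} (c : Fin (suc k) → Carrier) →
                         Nontrivial c → lincomb c (w ∷ V) ≈ᵥ 0ᵥ → LinIndep V → w ∈span V
  ∈span-of-dependent-∷ {w = w} {V} c c≢0 cwV≈0 V-indep with c zero ≟ 0#
  ... | no c₀≉0 = let (κ , solve) = linear-solution c₀≉0 in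
    _ , λ i → trans (solve (cwV≈0 i)) (lincomb-· κ (c ∘ suc) V i)
  ... | yes c₀≈0 = ⊥-elim (proj₂ c≢0 (all-zero (proj₁ c≢0)))
    where
    all-zero : ∀ j → c j ≈ 0#
    all-zero zero = c₀≈0
    all-zero (suc j) = V-indep (c ∘ suc) cV≈0 j
      where
      cV≈0 : lincomb (c ∘ suc) V ≈ᵥ 0ᵥ
      cV≈0 i = trans (sym (trans (+-congʳ (trans (*-congʳ c₀≈0) (zeroˡ (w i)))) (+-identityˡ _))) (cwV≈0 i)

  line-⊆-span : ∀ {k} (L : Line) (G : Fin k → Vect) {x y} → NonZeroV x → ¬ SamePoint x y →
                x ∈ₛ L → y ∈ₛ L → x ∈span G → y ∈span G → ∀ j → basis L j ∈span G
  line-⊆-span L G {x} {y} x≢0 x≁y x∈L y∈L x∈G y∈G j =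
    ∈span-trans {G = G} {x ∷ y ∷ []}
      (∈span-of-dependent-∷ {w = basis L j} {x ∷ y ∷ []} c c≢0 c≈0 (distinct-points-independent x≢0 x≁y))
      (λ { zero → x∈G ; (suc zero) → y∈G })
    where
    on-L : ∀ i → (basis L j ∷ x ∷ y ∷ []) i ∈ₛ L
    on-L zero = ∈span-member (basis L) j
    on-L (suc zero) = x∈L
    on-L (suc (suc zero)) = y∈L
    dependence = dependent (basis L j ∷ x ∷ y ∷ []) (basis L) on-L
    c = proj₁ dependence
    c≢0 = proj₁ (proj₂ dependence)
    c≈0 = proj₂ (proj₂ dependence)

  two-points-determine-line : (L M : Line) {x y : Vect} → NonZeroV x → ¬ SamePoint x y →
                              x ∈ₛ L → y ∈ₛ L → x ∈ₛ M → y ∈ₛ M → L ≈ₛ M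
  two-points-determine-line L M x≢0 x≁y x∈L y∈L x∈M y∈M =
    line-⊆-span L (basis M) x≢0 x≁y x∈L y∈L x∈M y∈M , line-⊆-span M (basis L) x≢0 x≁y x∈M y∈M x∈L y∈L

  line-meets-of-dependent : ∀ {k} (L : Line) (T : Subspace k) (c : Fin (suc (suc k)) → Carrier) →
    Nontrivial c → lincomb c (basis L zero ∷ basis L (suc zero) ∷ basis T) ≈ᵥ 0ᵥ →
    ∃ λ x → NonZeroV x × x ∈ₛ L × x ∈ₛ T
  line-meets-of-dependent {k} L T c c≢0 c≈0 = lincomb cL (basis L) , x≢0 , (cL , λ i → refl) , x∈T
    where
    cL : Fin 2 → Carrier
    cL = c zero ∷ c (suc zero) ∷ []
    cT : Fin k → Carrier
    cT j = c (suc (suc j))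
    x+y≈0 : ∀ i → lincomb cL (basis L) i + lincomb cT (basis T) i ≈ 0#
    x+y≈0 i = trans (trans (+-assoc _ _ _) (+-congˡ (trans (+-assoc _ _ _) (+-congˡ (+-identityˡ _))))) (c≈0 i)
    x∈T : lincomb cL (basis L) ∈ₛ T
    x∈T = (λ j → - 1# * cT j) , λ i →
      trans (+-inverseˡ-unique _ _ (x+y≈0 i)) (trans (sym (-1*x≈-x _)) (lincomb-· (- 1#) cT (basis T) i))
    x≢0 : NonZeroV (lincomb cL (basis L))
    x≢0 x≈0 = proj₂ c≢0 (all-zero (proj₁ c≢0))
      where
      all-zero : ∀ j → c j ≈ 0#
      all-zero zero = indep L cL x≈0 zero
      all-zero (suc zero) = indep L cL x≈0 (suc zero)
      all-zero (suc (suc j)) = indep T cT (λ i → trans (sym (trans (+-congʳ (x≈0 i)) (+-identityˡ _))) (x+y≈0 i)) j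

  line-meets-hyperplane : (L : Line) (H : Hyperplane) → ∃ λ x → NonZeroV x × x ∈ₛ L × x ∈ₛ H
  line-meets-hyperplane L H = line-meets-of-dependent L H c c≢0 (λ t → trans (lincomb-coord c V t) (cV≈0 t))
    where
    V : Fin (suc (suc n)) → Vect
    V = basis L zero ∷ basis L (suc zero) ∷ basis H
    dependence = dependent-rows (suc n) V
    c = proj₁ dependence
    c≢0 = proj₁ (proj₂ dependence)
    cV≈0 = proj₂ (proj₂ dependence)

  coplanar-lines-meet : (G : Fin 3 → Vect) (L M : Line) →
                        (∀ j → basis L j ∈span G) → (∀ j → basis M j ∈span G) → Meet L M
  coplanar-lines-meet G L M L⊆G M⊆G = line-meets-of-dependent L M c c≢0 c≈0
    where
    V : Fin 4 → Vect
    V = basis L zero ∷ basis L (suc zero) ∷ basis M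
    V⊆G : ∀ i → V i ∈span G
    V⊆G zero = L⊆G zero
    V⊆G (suc zero) = L⊆G (suc zero)
    V⊆G (suc (suc j)) = M⊆G j
    dependence = dependent V G V⊆G
    c = proj₁ dependence
    c≢0 = proj₁ (proj₂ dependence)
    c≈0 = proj₂ (proj₂ dependence)

  ≈ᵥ? : ∀ x y → Dec (x ≈ᵥ y)
  ≈ᵥ? x y = all? (λ i → x i ≟ y i)

  ∈span? : ∀ {k} x (G : Fin k → Vect) → Dec (x ∈span G)
  ∈span? {k} x G = ∃ⁿ? k (λ c≈d x≈cG → ≈ᵥ-trans x≈cG (lincomb-cong G c≈d)) (λ c → ≈ᵥ? x (lincomb c G))

  ⊆ₛ? : ∀ {k l} (S : Subspace k) (T : Subspace l) → Dec (S ⊆ₛ T)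
  ⊆ₛ? S T = all? (λ j → ∈span? (basis S j) (basis T))

  ≈ₛ? : ∀ {k l} (S : Subspace k) (T : Subspace l) → Dec (S ≈ₛ T)
  ≈ₛ? S T = ⊆ₛ? S T ×-dec ⊆ₛ? T S

  module Reguli (S : Solid) (ℓ m : Fin (suc q) → Line) (reg : IsRegulus S ℓ) (opp : IsOppositeRegulus S ℓ m) where

    ℓ-injective : ∀ i i′ → ℓ i ≈ₛ ℓ i′ → i ≡ i′
    ℓ-injective = proj₁ (proj₂ reg)

    ℓ-skew : ∀ i i′ → i ≢ i′ → Skew (ℓ i) (ℓ i′)
    ℓ-skew = proj₁ (proj₂ (proj₂ (proj₂ reg)))

    m-injective : ∀ j j′ → m j ≈ₛ m j′ → j ≡ j′
    m-injective = proj₁ opp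

    ℓ∩m : ∀ i j → MeetInExactlyOnePoint (ℓ i) (m j)
    ℓ∩m i j = proj₂ (proj₁ (proj₂ opp) j) i

    point : Fin (suc q) → Fin (suc q) → Vect
    point i j = proj₁ (proj₁ (ℓ∩m i j))

    point≢0 : ∀ i j → NonZeroV (point i j)
    point≢0 i j = proj₁ (proj₂ (proj₁ (ℓ∩m i j)))

    point∈ℓ : ∀ i j → point i j ∈ₛ ℓ i
    point∈ℓ i j = proj₁ (proj₂ (proj₂ (proj₁ (ℓ∩m i j))))

    point∈m : ∀ i j → point i j ∈ₛ m j
    point∈m i j = proj₂ (proj₂ (proj₂ (proj₁ (ℓ∩m i j))))

    same-point : ∀ {i j x y} → NonZeroV x → x ∈ₛ ℓ i → x ∈ₛ m j → NonZeroV y → y ∈ₛ ℓ i → y ∈ₛ m j → SamePoint x y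
    same-point {i} {j} {x} {y} = proj₂ (ℓ∩m i j) x y

    ℓ-unique : ∀ {i i′ x} → NonZeroV x → x ∈ₛ ℓ i → x ∈ₛ ℓ i′ → i ≡ i′
    ℓ-unique {i} {i′} {x} x≢0 x∈ℓᵢ x∈ℓᵢ′ with i Fin.≟ i′
    ... | yes i≡i′ = i≡i′
    ... | no i≢i′ = ⊥-elim (ℓ-skew i i′ i≢i′ (x , x≢0 , x∈ℓᵢ , x∈ℓᵢ′))

    m-through : ∀ {i x} → NonZeroV x → x ∈ₛ ℓ i → ∃ λ j → x ∈ₛ m j
    m-through {i} {x} x≢0 x∈ℓᵢ with proj₁ (proj₂ (proj₂ (proj₂ (proj₂ reg)))) i x x≢0 x∈ℓᵢ
    ... | t , t-transversal , x∈t with proj₂ (proj₂ opp) t t-transversal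
    ...   | j , t≈mⱼ = j , ⊆ₛ-∈ {S = t} {m j} (proj₁ t≈mⱼ) x∈t

    ℓ-through : ∀ {j x} → NonZeroV x → x ∈ₛ m j → ∃ λ i → x ∈ₛ ℓ i
    ℓ-through {j} {x} x≢0 x∈mⱼ = proj₂ (proj₂ (proj₂ (proj₂ (proj₂ reg)))) (m j) (proj₁ (proj₂ opp) j) x x≢0 x∈mⱼ

    ℓ≉m : ∀ i j → ¬ ℓ i ≈ₛ m j
    ℓ≉m i j (_ , mⱼ⊆ℓᵢ) with two-distinct-others 2≤q i
    ... | i′ , _ , _ , i′≢i , _ =
      ℓ-skew i i′ (i′≢i ∘ ≡.sym)
        (point i′ j , point≢0 i′ j , ⊆ₛ-∈ {S = m j} {ℓ i} mⱼ⊆ℓᵢ (point∈m i′ j) , point∈ℓ i′ j)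

    -- If two transversals met in P, the plane they span would contain the two lines ℓ a, ℓ b
    -- not through P (each meets both transversals in distinct points), so ℓ a and ℓ b would meet.
    m-unique : ∀ {j j′ P} → NonZeroV P → P ∈ₛ m j → P ∈ₛ m j′ → j ≡ j′
    m-unique {j} {j′} {P} P≢0 P∈mⱼ P∈mⱼ′ with j Fin.≟ j′
    ... | yes j≡j′ = j≡j′
    ... | no j≢j′ = ⊥-elim (ℓ-skew a b a≢b (coplanar-lines-meet plane (ℓ a) (ℓ b) (ℓ⊆plane a≢i₀) (ℓ⊆plane b≢i₀)))
      where
      i₀ = proj₁ (ℓ-through P≢0 P∈mⱼ)
      others = two-distinct-others 2≤q i₀
      a = proj₁ others
      b = proj₁ (proj₂ others)
      a≢b = proj₁ (proj₂ (proj₂ others))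
      a≢i₀ = proj₁ (proj₂ (proj₂ (proj₂ others)))
      b≢i₀ = proj₂ (proj₂ (proj₂ (proj₂ others)))

      plane : Fin 3 → Vect
      plane = P ∷ point a j ∷ point a j′ ∷ []

      ≁P : ∀ {i X} → i ≢ i₀ → X ∈ₛ ℓ i → ¬ SamePoint X P
      ≁P {i} i≢i₀ X∈ℓᵢ X~P = i≢i₀ (ℓ-unique P≢0 (SamePoint-∈ₛ (ℓ i) X~P X∈ℓᵢ) (proj₂ (ℓ-through P≢0 P∈mⱼ)))

      mⱼ⊆plane : ∀ k → basis (m j) k ∈span plane
      mⱼ⊆plane = line-⊆-span (m j) plane (point≢0 a j) (≁P a≢i₀ (point∈ℓ a j)) (point∈m a j) P∈mⱼ
                   (∈span-member plane (suc zero)) (∈span-member plane zero)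

      mⱼ′⊆plane : ∀ k → basis (m j′) k ∈span plane
      mⱼ′⊆plane = line-⊆-span (m j′) plane (point≢0 a j′) (≁P a≢i₀ (point∈ℓ a j′)) (point∈m a j′) P∈mⱼ′
                    (∈span-member plane (suc (suc zero))) (∈span-member plane zero)

      points-distinct : ∀ {i} → i ≢ i₀ → ¬ SamePoint (point i j) (point i j′)
      points-distinct {i} i≢i₀ p~p′ = j≢j′ (m-injective j j′
        (two-points-determine-line (m j) (m j′) (point≢0 i j′) (≁P i≢i₀ (point∈ℓ i j′))
                                   (SamePoint-∈ₛ (m j) p~p′ (point∈m i j)) P∈mⱼ (point∈m i j′) P∈mⱼ′))

      ℓ⊆plane : ∀ {i} → i ≢ i₀ → ∀ k → basis (ℓ i) k ∈span plane
      ℓ⊆plane {i} i≢i₀ = line-⊆-span (ℓ i) plane (point≢0 i j) (points-distinct i≢i₀) (point∈ℓ i j) (point∈ℓ i j′)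
        (∈span-trans {G = plane} {basis (m j)} (point∈m i j) mⱼ⊆plane)
        (∈span-trans {G = plane} {basis (m j′)} (point∈m i j′) mⱼ′⊆plane)

    module Affine (H : Hyperplane) (ℓ⊈H : ∀ i → ¬ ℓ i ⊆ₛ H) (m⊈H : ∀ j → ¬ m j ⊆ₛ H) where

      MeetInH : Fin (suc q) → Fin (suc q) → Set
      MeetInH i j = ∃ λ x → NonZeroV x × x ∈ₛ ℓ i × x ∈ₛ m j × x ∈ₛ H

      MeetInH-unique-m : ∀ {i j j′} → MeetInH i j → MeetInH i j′ → j ≡ j′
      MeetInH-unique-m {i} {j} {j′} (x , x≢0 , x∈ℓ , x∈m , x∈H) (y , y≢0 , y∈ℓ , y∈m , y∈H) with j Fin.≟ j′
      ... | yes j≡j′ = j≡j′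
      ... | no j≢j′ = ⊥-elim (ℓ⊈H i (line-⊆-span (ℓ i) (basis H) x≢0 x≁y x∈ℓ y∈ℓ x∈H y∈H))
        where x≁y = λ x~y → j≢j′ (m-unique y≢0 (SamePoint-∈ₛ (m j) x~y x∈m) y∈m)

      MeetInH-unique-ℓ : ∀ {i i′ j} → MeetInH i j → MeetInH i′ j → i ≡ i′
      MeetInH-unique-ℓ {i} {i′} {j} (x , x≢0 , x∈ℓ , x∈m , x∈H) (y , y≢0 , y∈ℓ , y∈m , y∈H) with i Fin.≟ i′
      ... | yes i≡i′ = i≡i′
      ... | no i≢i′ = ⊥-elim (m⊈H j (line-⊆-span (m j) (basis H) x≢0 x≁y x∈m y∈m x∈H y∈H))
        where x≁y = λ x~y → i≢i′ (ℓ-unique y≢0 (SamePoint-∈ₛ (ℓ i) x~y x∈ℓ) y∈ℓ)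

      MeetInH⇒∈H : ∀ {i j x} → MeetInH i j → NonZeroV x → x ∈ₛ ℓ i → x ∈ₛ m j → x ∈ₛ H
      MeetInH⇒∈H (y , y≢0 , y∈ℓ , y∈m , y∈H) x≢0 x∈ℓ x∈m =
        SamePoint-∈ₛ H (same-point y≢0 y∈ℓ y∈m x≢0 x∈ℓ x∈m) y∈H

      ℓ-meets-some-m-in-H : ∀ i → ∃ (MeetInH i)
      ℓ-meets-some-m-in-H i with line-meets-hyperplane (ℓ i) H
      ... | x , x≢0 , x∈ℓ , x∈H with m-through x≢0 x∈ℓ
      ...   | j , x∈m = j , x , x≢0 , x∈ℓ , x∈m , x∈H

      σ : Fin (suc q) → Fin (suc q)
      σ i = proj₁ (ℓ-meets-some-m-in-H i)

      σ-MeetInH : ∀ i → MeetInH i (σ i)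
      σ-MeetInH i = proj₂ (ℓ-meets-some-m-in-H i)

      σ-injective : ∀ {i i′} → σ i ≡ σ i′ → i ≡ i′
      σ-injective {i} {i′} σi≡σi′ = MeetInH-unique-ℓ (σ-MeetInH i) (≡.subst (MeetInH i′) (≡.sym σi≡σi′) (σ-MeetInH i′))

      σ-surjective : ∀ j → ∃ λ i → σ i ≡ j
      σ-surjective j with line-meets-hyperplane (m j) H
      ... | x , x≢0 , x∈m , x∈H with ℓ-through x≢0 x∈m
      ...   | i , x∈ℓ = i , MeetInH-unique-m (σ-MeetInH i) (x , x≢0 , x∈ℓ , x∈m , x∈H)

      L M : Fin (suc q) → AffLine H
      L i = ℓ i , ℓ⊈H i
      M j = m j , m⊈H j

      _≈ₐ_ : AffLine H → AffLine H → Set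
      _≈ₐ_ = _≈ᵃ_ {H}

      Adj : AffLine H → AffLine H → Set
      Adj = AdjY H

      Adj-sym : ∀ {u w : AffLine H} → Adj u w → Adj w u
      Adj-sym {u} {w} (u≉w , x , x≢0 , x∈u , x∈w , x∉H) =
        (λ w≈u → u≉w (≈ₛ-sym {S = proj₁ w} {proj₁ u} w≈u)) , x , x≢0 , x∈w , x∈u , x∉H

      Adj-respˡ : ∀ {u u′ w} → u ≈ₐ u′ → Adj u w → Adj u′ w
      Adj-respˡ {u} {u′} {w} u≈u′ (u≉w , x , x≢0 , x∈u , x∈w , x∉H) =
        (λ u′≈w → u≉w (≈ₛ-trans {S = proj₁ u} {proj₁ u′} {proj₁ w} u≈u′ u′≈w)) ,
        x , x≢0 , ⊆ₛ-∈ {S = proj₁ u} {proj₁ u′} (proj₁ u≈u′) x∈u , x∈w , x∉H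

      Adj-respʳ : ∀ {u w w′} → w ≈ₐ w′ → Adj u w → Adj u w′
      Adj-respʳ {u} {w} {w′} w≈w′ = Adj-sym {w′} {u} ∘ Adj-respˡ {w} {w′} {u} w≈w′ ∘ Adj-sym {u} {w}

      ¬Adj-L-L : ∀ i i′ → ¬ Adj (L i) (L i′)
      ¬Adj-L-L i i′ (Lᵢ≉Lᵢ′ , x , x≢0 , x∈ℓᵢ , x∈ℓᵢ′ , _) =
        Lᵢ≉Lᵢ′ (≡.subst (λ k → ℓ i ≈ₛ ℓ k) (ℓ-unique x≢0 x∈ℓᵢ x∈ℓᵢ′) (≈ₛ-refl (ℓ i)))

      ¬Adj-M-M : ∀ j j′ → ¬ Adj (M j) (M j′)
      ¬Adj-M-M j j′ (Mⱼ≉Mⱼ′ , x , x≢0 , x∈mⱼ , x∈mⱼ′ , _) =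
        Mⱼ≉Mⱼ′ (≡.subst (λ k → m j ≈ₛ m k) (m-unique x≢0 x∈mⱼ x∈mⱼ′) (≈ₛ-refl (m j)))

      Adj-L-M : ∀ {i j} → j ≢ σ i → Adj (L i) (M j)
      Adj-L-M {i} {j} j≢σi = ℓ≉m i j , point i j , point≢0 i j , point∈ℓ i j , point∈m i j ,
        λ p∈H → j≢σi (MeetInH-unique-m (point i j , point≢0 i j , point∈ℓ i j , point∈m i j , p∈H) (σ-MeetInH i))

      ¬Adj-L-Mσ : ∀ i → ¬ Adj (L i) (M (σ i))
      ¬Adj-L-Mσ i (_ , x , x≢0 , x∈ℓ , x∈m , x∉H) = x∉H (MeetInH⇒∈H (σ-MeetInH i) x≢0 x∈ℓ x∈m)

module ReguliEigenfunction {q : ℕ} (F : FiniteField q) (n : ℕ)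
    (S : PG.Solid F n) (H : PG.Hyperplane F n) (ℓ m : Fin (suc q) → PG.Line F n)
    (reg : PG.IsRegulus F n S ℓ) (opp : PG.IsOppositeRegulus F n S ℓ m)
    (ℓ⊈H : ∀ i → ¬ PG._⊆ₛ_ F n (ℓ i) H) (m⊈H : ∀ j → ¬ PG._⊆ₛ_ F n (m j) H)
    (f : PG.AffLine F n H → Data.Integer.ℤ) (f-values : PG.IsReguliFunction F n H ℓ m f) where
  open PG F n
  open Projective F n
  open Reguli S ℓ m reg opp
  open Affine H ℓ⊈H m⊈H
  open IntegerSums
  open SetoidGraph _≈ₐ_ Adj
  open AdjacencyIndicators _≈ₐ_ Adj
  open import Data.Integer using (ℤ; +_; _+_; _-_; _*_; -_)
  import Data.Integer.Properties as ℤ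
  open ≡ using (cong; cong₂; sym; trans)

  ≈-isDecEquivalence : IsDecEquivalence _≈ₐ_
  ≈-isDecEquivalence = record
    { isEquivalence = record
      { refl = λ {u} → ≈ₛ-refl (proj₁ u)
      ; sym = λ {u} {v} → ≈ₛ-sym {S = proj₁ u} {proj₁ v}
      ; trans = λ {u} {v} {w} → ≈ₛ-trans {S = proj₁ u} {proj₁ v} {proj₁ w} }
    ; _≟_ = λ u v → ≈ₛ? (proj₁ u) (proj₁ v) }
  open IsDecEquivalence ≈-isDecEquivalence using () renaming (refl to ≈-refl; sym to ≈-sym; trans to ≈-trans)

  f-on-R : ∀ {v} i → v ≈ₐ L i → f v ≡ + 1
  f-on-R = proj₁ f-values _

  f-on-Ropp : ∀ {v} j → v ≈ₐ M j → f v ≡ - + 1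
  f-on-Ropp = proj₁ (proj₂ f-values) _

  f-off : ∀ {v} → (∀ i → ¬ v ≈ₐ L i) → (∀ j → ¬ v ≈ₐ M j) → f v ≡ + 0
  f-off = proj₂ (proj₂ f-values) _

  data Position (u : AffLine H) : Set where
    on-R    : ∀ i → u ≈ₐ L i → Position u
    on-Ropp : ∀ j → u ≈ₐ M j → Position u
    off     : (∀ i → ¬ u ≈ₐ L i) → (∀ j → ¬ u ≈ₐ M j) → Position u

  position : ∀ u → Position u
  position u with any? (λ i → ≈ₛ? (proj₁ u) (ℓ i)) | any? (λ j → ≈ₛ? (proj₁ u) (m j))
  ... | yes (i , u≈Lᵢ) | _ = on-R i u≈Lᵢ
  ... | no _ | yes (j , u≈Mⱼ) = on-Ropp j u≈Mⱼ
  ... | no ≉L | no ≉M = off (λ i u≈Lᵢ → ≉L (i , u≈Lᵢ)) (λ j u≈Mⱼ → ≉M (j , u≈Mⱼ))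

  f-resp : ∀ u v → u ≈ₐ v → f u ≡ f v
  f-resp u v u≈v with position u
  ... | on-R i u≈Lᵢ = trans (f-on-R {u} i u≈Lᵢ) (sym (f-on-R {v} i (≈-trans {v} {u} {L i} (≈-sym {u} {v} u≈v) u≈Lᵢ)))
  ... | on-Ropp j u≈Mⱼ = trans (f-on-Ropp {u} j u≈Mⱼ) (sym (f-on-Ropp {v} j (≈-trans {v} {u} {M j} (≈-sym {u} {v} u≈v) u≈Mⱼ)))
  ... | off ≉L ≉M = trans (f-off {u} ≉L ≉M)
    (sym (f-off {v} (λ i v≈Lᵢ → ≉L i (≈-trans {u} {v} {L i} u≈v v≈Lᵢ)) (λ j v≈Mⱼ → ≉M j (≈-trans {u} {v} {M j} u≈v v≈Mⱼ))))

  reguli : Fin (suc q) ⊎ Fin (suc q) → AffLine H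
  reguli = [ L , M ]

  reguli-injective : ∀ x y → reguli x ≈ₐ reguli y → x ≡ y
  reguli-injective (inj₁ i) (inj₁ i′) Lᵢ≈Lᵢ′ = cong inj₁ (ℓ-injective i i′ Lᵢ≈Lᵢ′)
  reguli-injective (inj₁ i) (inj₂ j) Lᵢ≈Mⱼ = ⊥-elim (ℓ≉m i j Lᵢ≈Mⱼ)
  reguli-injective (inj₂ j) (inj₁ i) Mⱼ≈Lᵢ = ⊥-elim (ℓ≉m i j (≈-sym {M j} {L i} Mⱼ≈Lᵢ))
  reguli-injective (inj₂ j) (inj₂ j′) Mⱼ≈Mⱼ′ = cong inj₂ (m-injective j j′ Mⱼ≈Mⱼ′)

  reguli-onto-support : ∀ v → f v ≢ + 0 → ∃ λ x → reguli x ≈ₐ v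
  reguli-onto-support v fv≢0 with position v
  ... | on-R i v≈Lᵢ = inj₁ i , ≈-sym {v} {L i} v≈Lᵢ
  ... | on-Ropp j v≈Mⱼ = inj₂ j , ≈-sym {v} {M j} v≈Mⱼ
  ... | off ≉L ≉M = ⊥-elim (fv≢0 (f-off {v} ≉L ≉M))

  *-neg-one : ∀ i → i * - + 1 ≡ - i
  *-neg-one i = trans (ℤ.*-comm i (- + 1)) (ℤ.-1*i≡-i i)

  module NeighbourSums {N} (e : Fin N → AffLine H) (e-enum : IsEnumeration N e)
                       (a : AffLine H → AffLine H → ℤ) (a-ind : IsAdjIndicator a) where
    open ≡.≡-Reasoning

    a-adj : ∀ {u w} → Adj u w → a u w ≡ + 1
    a-adj {u} {w} = proj₁ (a-ind u w)

    a-¬adj : ∀ {u w} → ¬ Adj u w → a u w ≡ + 0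
    a-¬adj {u} {w} = proj₂ (a-ind u w)

    neighbourSum-reguli : ∀ u → neighbourSum e a f u ≡ sumℤ (λ i → a u (L i)) - sumℤ (λ j → a u (M j))
    neighbourSum-reguli u = begin
      sumℤ (g ∘ e)                                     ≡⟨ sum-over-enumeration e e-onto e-injective φ φ-injective g g-resp g-support ⟩
      sumℤ (g ∘ reguli ∘ splitAt (suc q))              ≡⟨ sumℤ-splitAt (suc q) (g ∘ reguli) ⟩
      sumℤ (g ∘ L) + sumℤ (g ∘ M)                      ≡⟨ cong₂ _+_ (sumℤ-cong g-L) (trans (sumℤ-cong g-M) (sumℤ-neg (λ j → a u (M j)))) ⟩
      sumℤ (λ i → a u (L i)) - sumℤ (λ j → a u (M j))  ∎
      where
      open EnumerationSums ≈-isDecEquivalence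
      e-onto = proj₁ e-enum
      e-injective = proj₂ e-enum
      g : AffLine H → ℤ
      g w = a u w * f w
      φ : Fin (suc q ℕ.+ suc q) → AffLine H
      φ = reguli ∘ splitAt (suc q)
      φ-injective : ∀ x y → φ x ≈ₐ φ y → x ≡ y
      φ-injective x y φx≈φy = trans (sym (join-splitAt (suc q) (suc q) x))
        (trans (cong (join (suc q) (suc q)) (reguli-injective (splitAt (suc q) x) (splitAt (suc q) y) φx≈φy))
               (join-splitAt (suc q) (suc q) y))
      g-resp : ∀ {w w′} → w ≈ₐ w′ → g w ≡ g w′
      g-resp {w} {w′} w≈w′ =
        cong₂ _*_ (adjIndicator-cong a-ind (Adj-respʳ {u} {w} {w′} w≈w′) (Adj-respʳ {u} {w′} {w} (≈-sym {w} {w′} w≈w′)))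
                  (f-resp w w′ w≈w′)
      g-support : ∀ v → g v ≢ + 0 → ∃ λ x → φ x ≈ₐ v
      g-support v gv≢0 with reguli-onto-support v (λ fv≡0 → gv≢0 (trans (cong (a u v *_) fv≡0) (ℤ.*-zeroʳ (a u v))))
      ... | x , reguli-x≈v = join (suc q) (suc q) x , ≡.subst (λ y → reguli y ≈ₐ v) (sym (splitAt-join (suc q) (suc q) x)) reguli-x≈v
      g-L : ∀ i → g (L i) ≡ a u (L i)
      g-L i = trans (cong (a u (L i) *_) (f-on-R {L i} i (≈-refl {L i}))) (ℤ.*-identityʳ (a u (L i)))
      g-M : ∀ j → g (M j) ≡ - a u (M j)
      g-M j = trans (cong (a u (M j) *_) (f-on-Ropp {M j} j (≈-refl {M j}))) (*-neg-one (a u (M j)))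

    eigen-on-R : ∀ {u} i → u ≈ₐ L i → - + q * f u ≡ neighbourSum e a f u
    eigen-on-R {u} i₀ u≈L = begin
      - + q * f u                                       ≡⟨ cong (- + q *_) (f-on-R {u} i₀ u≈L) ⟩
      - + q * + 1                                       ≡⟨ ℤ.*-identityʳ (- + q) ⟩
      - + q                                             ≡⟨ ℤ.+-identityˡ (- + q) ⟨
      + 0 - + q                                         ≡⟨ cong₂ _-_ no-L q-M ⟨
      sumℤ (λ i → a u (L i)) - sumℤ (λ j → a u (M j))   ≡⟨ neighbourSum-reguli u ⟨
      neighbourSum e a f u                              ∎
      where
      no-L : sumℤ (λ i → a u (L i)) ≡ + 0
      no-L = sumℤ-zero (λ i → a u (L i)) λ i → a-¬adj (¬Adj-L-L i₀ i ∘ Adj-respˡ {u} {L i₀} {L i} u≈L)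
      q-M : sumℤ (λ j → a u (M j)) ≡ + q
      q-M = sumℤ-count (λ j → a u (M j)) (σ i₀) (a-¬adj (¬Adj-L-Mσ i₀ ∘ Adj-respˡ {u} {L i₀} {M (σ i₀)} u≈L))
                             (λ j j≢σi₀ → a-adj (Adj-respˡ {L i₀} {u} {M j} (≈-sym {u} {L i₀} u≈L) (Adj-L-M j≢σi₀)))

    eigen-on-Ropp : ∀ {u} j → u ≈ₐ M j → - + q * f u ≡ neighbourSum e a f u
    eigen-on-Ropp {u} j₀ u≈M = begin
      - + q * f u                                       ≡⟨ cong (- + q *_) (f-on-Ropp {u} j₀ u≈M) ⟩
      - + q * - + 1                                     ≡⟨ *-neg-one (- + q) ⟩
      - - + q                                           ≡⟨ ℤ.neg-involutive (+ q) ⟩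
      + q                                               ≡⟨ ℤ.+-identityʳ (+ q) ⟨
      + q - + 0                                         ≡⟨ cong₂ _-_ q-L no-M ⟨
      sumℤ (λ i → a u (L i)) - sumℤ (λ j → a u (M j))   ≡⟨ neighbourSum-reguli u ⟨
      neighbourSum e a f u                              ∎
      where
      i₀ = proj₁ (σ-surjective j₀)
      σi₀≡j₀ = proj₂ (σ-surjective j₀)
      Adj-L-Mⱼ₀ : ∀ {i} → i ≢ i₀ → Adj (L i) (M j₀)
      Adj-L-Mⱼ₀ i≢i₀ = Adj-L-M (λ j₀≡σi → i≢i₀ (σ-injective (trans (sym j₀≡σi) (sym σi₀≡j₀))))
      ¬Adj-Lᵢ₀-Mⱼ₀ : ¬ Adj (L i₀) (M j₀)
      ¬Adj-Lᵢ₀-Mⱼ₀ = ≡.subst (λ j → ¬ Adj (L i₀) (M j)) σi₀≡j₀ (¬Adj-L-Mσ i₀)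
      q-L : sumℤ (λ i → a u (L i)) ≡ + q
      q-L = sumℤ-count (λ i → a u (L i)) i₀ (a-¬adj (¬Adj-Lᵢ₀-Mⱼ₀ ∘ Adj-sym {M j₀} {L i₀} ∘ Adj-respˡ {u} {M j₀} {L i₀} u≈M))
                           (λ i i≢i₀ → a-adj (Adj-respˡ {M j₀} {u} {L i} (≈-sym {u} {M j₀} u≈M) (Adj-sym {L i} {M j₀} (Adj-L-Mⱼ₀ i≢i₀))))
      no-M : sumℤ (λ j → a u (M j)) ≡ + 0
      no-M = sumℤ-zero (λ j → a u (M j)) λ j → a-¬adj (¬Adj-M-M j₀ j ∘ Adj-respˡ {u} {M j₀} {M j} u≈M)

    module Off {u} (≉L : ∀ i → ¬ u ≈ₐ L i) (≉M : ∀ j → ¬ u ≈ₐ M j) where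
      Through : Fin (suc q) → Fin (suc q) → Set
      Through i j = point i j ∈ₛ proj₁ u × ¬ point i j ∈ₛ H

      Through? : ∀ i j → Dec (Through i j)
      Through? i j = ∈span? (point i j) (basis (proj₁ u)) ×-dec ¬? (∈span? (point i j) (basis H))

      Through⇒Adj-L : ∀ {i j} → Through i j → Adj u (L i)
      Through⇒Adj-L {i} {j} (p∈u , p∉H) = ≉L i , point i j , point≢0 i j , p∈u , point∈ℓ i j , p∉H

      Through⇒Adj-M : ∀ {i j} → Through i j → Adj u (M j)
      Through⇒Adj-M {i} {j} (p∈u , p∉H) = ≉M j , point i j , point≢0 i j , p∈u , point∈m i j , p∉H

      through-point : ∀ {i j x} → NonZeroV x → x ∈ₛ ℓ i → x ∈ₛ m j → x ∈ₛ proj₁ u → ¬ x ∈ₛ H → Through i j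
      through-point {i} {j} x≢0 x∈ℓ x∈m x∈u x∉H =
        SamePoint-∈ₛ (proj₁ u) (same-point x≢0 x∈ℓ x∈m (point≢0 i j) (point∈ℓ i j) (point∈m i j)) x∈u ,
        λ p∈H → x∉H (SamePoint-∈ₛ H (same-point (point≢0 i j) (point∈ℓ i j) (point∈m i j) x≢0 x∈ℓ x∈m) p∈H)

      Adj-L⇒Through : ∀ {i} → Adj u (L i) → ∃ (Through i)
      Adj-L⇒Through (_ , x , x≢0 , x∈u , x∈ℓ , x∉H) with m-through x≢0 x∈ℓ
      ... | j , x∈m = j , through-point x≢0 x∈ℓ x∈m x∈u x∉H

      Adj-M⇒Through : ∀ {j} → Adj u (M j) → ∃ λ i → Through i j
      Adj-M⇒Through (_ , x , x≢0 , x∈u , x∈m , x∉H) with ℓ-through x≢0 x∈m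
      ... | i , x∈ℓ = i , through-point x≢0 x∈ℓ x∈m x∈u x∉H

      Through-unique-m : ∀ {i j j′} → Through i j → Through i j′ → j ≡ j′
      Through-unique-m {i} {j} {j′} (p∈u , _) (p′∈u , _) with j Fin.≟ j′
      ... | yes j≡j′ = j≡j′
      ... | no j≢j′ =
        ⊥-elim (≉L i (two-points-determine-line (proj₁ u) (ℓ i) (point≢0 i j) p≁p′ p∈u p′∈u (point∈ℓ i j) (point∈ℓ i j′)))
        where p≁p′ = λ p~p′ → j≢j′ (m-unique (point≢0 i j′) (SamePoint-∈ₛ (m j) p~p′ (point∈m i j)) (point∈m i j′))

      Through-unique-ℓ : ∀ {i i′ j} → Through i j → Through i′ j → i ≡ i′
      Through-unique-ℓ {i} {i′} {j} (p∈u , _) (p′∈u , _) with i Fin.≟ i′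
      ... | yes i≡i′ = i≡i′
      ... | no i≢i′ =
        ⊥-elim (≉M j (two-points-determine-line (proj₁ u) (m j) (point≢0 i j) p≁p′ p∈u p′∈u (point∈m i j) (point∈m i′ j)))
        where p≁p′ = λ p~p′ → i≢i′ (ℓ-unique (point≢0 i′ j) (SamePoint-∈ₛ (ℓ i) p~p′ (point∈ℓ i j)) (point∈ℓ i′ j))

      a-L : ∀ i → a u (L i) ≡ sumℤ (λ j → indicator (Through? i j))
      a-L i = trans (adjIndicator≡indicator a-ind (any? (Through? i)) Adj-L⇒Through (Through⇒Adj-L ∘ proj₂))
                    (sym (sumℤ-indicator-unique (Through? i) Through-unique-m))

      a-M : ∀ j → a u (M j) ≡ sumℤ (λ i → indicator (Through? i j))
      a-M j = trans (adjIndicator≡indicator a-ind (any? (λ i → Through? i j)) Adj-M⇒Through (Through⇒Adj-M ∘ proj₂))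
                    (sym (sumℤ-indicator-unique (λ i → Through? i j) Through-unique-ℓ))

      balanced : sumℤ (λ i → a u (L i)) ≡ sumℤ (λ j → a u (M j))
      balanced = trans (sumℤ-cong a-L) (trans (sumℤ-comm (λ i j → indicator (Through? i j))) (sym (sumℤ-cong a-M)))

    eigen-off : ∀ {u} → (∀ i → ¬ u ≈ₐ L i) → (∀ j → ¬ u ≈ₐ M j) → - + q * f u ≡ neighbourSum e a f u
    eigen-off {u} ≉L ≉M = begin
      - + q * f u                                       ≡⟨ cong (- + q *_) (f-off {u} ≉L ≉M) ⟩
      - + q * + 0                                       ≡⟨ ℤ.*-zeroʳ (- + q) ⟩
      + 0                                               ≡⟨ ℤ.+-inverseʳ (sumℤ (λ j → a u (M j))) ⟨
      sumℤ (λ j → a u (M j)) - sumℤ (λ j → a u (M j))   ≡⟨ cong (_- sumℤ (λ j → a u (M j))) (Off.balanced ≉L ≉M) ⟨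
      sumℤ (λ i → a u (L i)) - sumℤ (λ j → a u (M j))   ≡⟨ neighbourSum-reguli u ⟨
      neighbourSum e a f u                              ∎

    eigen-equation : ∀ u → - + q * f u ≡ neighbourSum e a f u
    eigen-equation u with position u
    ... | on-R i u≈Lᵢ = eigen-on-R i u≈Lᵢ
    ... | on-Ropp j u≈Mⱼ = eigen-on-Ropp j u≈Mⱼ
    ... | off ≉L ≉M = eigen-off ≉L ≉M

  f-L≢0 : ∀ i → f (L i) ≢ + 0
  f-L≢0 i fLᵢ≡0 = +1≢+0 (trans (sym (f-on-R {L i} i (≈-refl {L i}))) fLᵢ≡0)
    where +1≢+0 : + 1 ≢ + 0
          +1≢+0 ()

  f-M≢0 : ∀ j → f (M j) ≢ + 0
  f-M≢0 j fMⱼ≡0 = -1≢+0 (trans (sym (f-on-Ropp {M j} j (≈-refl {M j}))) fMⱼ≡0)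
    where -1≢+0 : - + 1 ≢ + 0
          -1≢+0 ()

  isEigenfunction : IsEigenfunction (- + q) f
  isEigenfunction = f-resp , (L zero , f-L≢0 zero) , λ N e e-enum a a-ind → NeighbourSums.eigen-equation e e-enum a a-ind

  -- R' ∪ (R^opp)' listed so that the removed perfect matching is inj₁ i ↔ inj₂ i
  matched : Fin (suc q) ⊎ Fin (suc q) → AffLine H
  matched = [ L , M ∘ σ ]

  matched-injective : ∀ x y → matched x ≈ₐ matched y → x ≡ y
  matched-injective (inj₁ i) (inj₁ i′) Lᵢ≈Lᵢ′ = reguli-injective (inj₁ i) (inj₁ i′) Lᵢ≈Lᵢ′
  matched-injective (inj₁ i) (inj₂ j) Lᵢ≈M = ⊥-elim (ℓ≉m i (σ j) Lᵢ≈M)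
  matched-injective (inj₂ j) (inj₁ i) M≈Lᵢ = ⊥-elim (ℓ≉m i (σ j) (≈-sym {M (σ j)} {L i} M≈Lᵢ))
  matched-injective (inj₂ j) (inj₂ j′) M≈M′ = cong inj₂ (σ-injective (m-injective (σ j) (σ j′) M≈M′))

  matched-onto-support : ∀ v → f v ≢ + 0 → ∃ λ x → matched x ≈ₐ v
  matched-onto-support v fv≢0 with reguli-onto-support v fv≢0
  ... | inj₁ i , Lᵢ≈v = inj₁ i , Lᵢ≈v
  ... | inj₂ j , Mⱼ≈v = inj₂ (proj₁ (σ-surjective j)) , ≡.subst (λ k → M k ≈ₐ v) (sym (proj₂ (σ-surjective j))) Mⱼ≈v

  matched-adj⇒ : ∀ x y → Adj (matched x) (matched y) → KMinusPMAdj x y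
  matched-adj⇒ (inj₁ i) (inj₁ i′) adj = ¬Adj-L-L i i′ adj
  matched-adj⇒ (inj₁ i) (inj₂ j) adj ≡.refl = ¬Adj-L-Mσ i adj
  matched-adj⇒ (inj₂ j) (inj₁ i) adj ≡.refl = ¬Adj-L-Mσ i (Adj-sym {M (σ i)} {L i} adj)
  matched-adj⇒ (inj₂ j) (inj₂ j′) adj = ¬Adj-M-M (σ j) (σ j′) adj

  matched-adj⇐ : ∀ x y → KMinusPMAdj x y → Adj (matched x) (matched y)
  matched-adj⇐ (inj₁ i) (inj₂ j) i≢j = Adj-L-M (λ σj≡σi → i≢j (sym (σ-injective σj≡σi)))
  matched-adj⇐ (inj₂ j) (inj₁ i) j≢i = Adj-sym {L i} {M (σ j)} (Adj-L-M (λ σj≡σi → j≢i (σ-injective σj≡σi)))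

  supportInducesKMinusPM : SupportInducesKMinusPM f (suc q)
  supportInducesKMinusPM =
    matched , [ f-L≢0 , f-M≢0 ∘ σ ] , matched-onto-support , matched-injective , matched-adj⇒ , matched-adj⇐

open import Data.Integer using (ℤ; +_; -_)

proposition1p4 : (q : ℕ) (F : FiniteField q) (n : ℕ) → 3 ≤ n →
    let open PG F n in
    (S : Solid) (H : Hyperplane) (ℓ m : Fin (suc q) → Line) →
    IsRegulus S ℓ → IsOppositeRegulus S ℓ m →
    (∀ i → ¬ (ℓ i ⊆ₛ H)) → (∀ i → ¬ (m i ⊆ₛ H)) →
    (f : AffLine H → ℤ) → IsReguliFunction H ℓ m f →
    SetoidGraph.IsEigenfunction (_≈ᵃ_ {H}) (AdjY H) (- (+ q)) f
      × SetoidGraph.SupportInducesKMinusPM (_≈ᵃ_ {H}) (AdjY H) f (suc q)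
-- n ≥ 3 only guarantees that a solid S exists; the argument never uses it.
proposition1p4 q F n _ S H ℓ m reg opp ℓ⊈H m⊈H f f-values = isEigenfunction , supportInducesKMinusPM
  where open ReguliEigenfunction F n S H ℓ m reg opp ℓ⊈H m⊈H f f-values
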